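{- (Polynomially Many vs. All.) Let $f:\mathbb{N}\to\mathbb{N}$ satisfy $\lim_{n\to\infty} f(n) = \infty$ and $f(n) = O(n^k)$ for some constant $k$. Then for every $\varepsilon>0$ there is a constant $C$, independent of $n$ (the paper writes $O_{k,\varepsilon}(1)$), such that for every $n$ and every set $\mathcal{A} \subseteq \{0,1\}^n$ with $|\mathcal{A}| = f(n)$, there is a first-order $\tau_{\mathsf{string}}$-sentence with at most $(1+\varepsilon)\log(n) + C$ quantifiers that is true in $\mathbf{B}_w$ for every $w \in \mathcal{A}$ and false in $\mathbf{B}_{w'}$ for every $w' \in \{0,1\}^n \setminus \mathcal{A}$.
   Context: $\tau_{\mathsf{string}} = \langle <, S; \mathsf{min}, \mathsf{max}\rangle$ with $<$ binary, $S$ unary, $\mathsf{min},\mathsf{max}$ constants. A string $w = w_1\cdots w_n \in \{0,1\}^n$ is encoded by the structure $\mathbf{B}_w$ with universe $\{1,\dots,n\}$, $<$ the usual order, $S = \{i : w_i = 1\}$, $\mathsf{min}=1$, $\mathsf{max}=n$. The number of quantifiers of a sentence is the number of quantifier occurrences. $\log$ is base 2.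
   Formalization: The parameter ε ranges over the positive rationals. -}

module Defs where

open import Data.Nat using (ℕ; zero; suc; _+_; _*_; _∸_; _^_; _≤_; _<_)
open import Data.Fin as F using (Fin)
open import Data.Vec using (Vec; lookup)
open import Data.Bool using (Bool; true)
open import Data.Product using (Σ; _×_; ∃)
open import Data.Sum using (_⊎_)
open import Relation.Nullary using (¬_)
open import Relation.Binary.PropositionalEquality using (_≡_)

-- First-order formulas over τ_string = ⟨ <, S ; min, max ⟩ (with equality),
-- with de Bruijn variables: Formula v has v free variables available.
data Term (v : ℕ) : Set where
  var  : Fin v → Term v
  tmin : Term v
  tmax : Term v

data Formula : ℕ → Set where
  _≐_  : ∀ {v} → Term v → Term v → Formula v
  _≺_  : ∀ {v} → Term v → Term v → Formula v
  S    : ∀ {v} → Term v → Formula v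
  ¬'_  : ∀ {v} → Formula v → Formula v
  _∧'_ : ∀ {v} → Formula v → Formula v → Formula v
  _∨'_ : ∀ {v} → Formula v → Formula v → Formula v
  ∃'   : ∀ {v} → Formula (suc v) → Formula v
  ∀'   : ∀ {v} → Formula (suc v) → Formula v

Sentence : Set
Sentence = Formula 0

qcount : ∀ {v} → Formula v → ℕ
qcount (t ≐ u)   = 0
qcount (t ≺ u)   = 0
qcount (S t)     = 0
qcount (¬' φ)    = qcount φ
qcount (φ ∧' ψ)  = qcount φ + qcount ψ
qcount (φ ∨' ψ)  = qcount φ + qcount ψ
qcount (∃' φ)    = suc (qcount φ)
qcount (∀' φ)    = suc (qcount φ)

-- The structure B_w for w ∈ {0,1}^(suc m): universe Fin (suc m)
-- (element i ↔ position i+1), usual order, S = positions carrying 1,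
-- min = first position, max = last position.
Env : ℕ → ℕ → Set
Env m v = Fin v → Fin (suc m)

evalT : ∀ {m v} → Env m v → Term v → Fin (suc m)
evalT ρ (var i) = ρ i
evalT ρ tmin    = F.zero
evalT ρ tmax    = F.fromℕ _

extend : ∀ {m v} → Fin (suc m) → Env m v → Env m (suc v)
extend a ρ F.zero    = a
extend a ρ (F.suc i) = ρ i

Sat : ∀ {m v} → Vec Bool (suc m) → Env m v → Formula v → Set
Sat w ρ (t ≐ u)  = evalT ρ t ≡ evalT ρ u
Sat w ρ (t ≺ u)  = evalT ρ t F.< evalT ρ u
Sat w ρ (S t)    = lookup w (evalT ρ t) ≡ true
Sat w ρ (¬' φ)   = ¬ Sat w ρ φ
Sat w ρ (φ ∧' ψ) = Sat w ρ φ × Sat w ρ ψ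
Sat w ρ (φ ∨' ψ) = Sat w ρ φ ⊎ Sat w ρ ψ
Sat w ρ (∃' φ)   = Σ (Fin (suc _)) λ a → Sat w (extend a ρ) φ
Sat w ρ (∀' φ)   = (a : Fin (suc _)) → Sat w (extend a ρ) φ

emptyEnv : ∀ {m} → Env m 0
emptyEnv ()

_⊨_ : ∀ {m} → Vec Bool (suc m) → Sentence → Set
w ⊨ φ = Sat w emptyEnv φ

TendsToInfinity : (ℕ → ℕ) → Set
TendsToInfinity f = ∀ M → ∃ λ N → ∀ n → N ≤ n → M ≤ f n

BigOPow : (ℕ → ℕ) → ℕ → Set
BigOPow f k = ∃ λ c → ∃ λ N → ∀ n → N ≤ n → f n ≤ c * n ^ k

-- q ≤ (1 + a/b)·log₂ n + C  (real log), written without reals: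
-- for b ≥ 1, n ≥ 1 this is equivalent to  2^(b·(q ∸ C)) ≤ n^(a+b).
QuantBound : (a b C n q : ℕ) → Set
QuantBound a b C n q = 2 ^ (b * (q ∸ C)) ≤ n ^ (a + b)

module Submission where

-- The sentence guesses R "rungs" (positions serving as the R digit symbols) and the t₁ base-R
-- digits of an index i, and then says: every position p has t₂ base-R digits e such that p is
-- the e-th position and carries the letter that the i-th word of A has at e. With R a large
-- constant and |A| polynomial in n, the digits cost only ε log n quantifiers. The remaining
-- log n + O(1) quantifiers express "p is the e-th position": the distances e and n - 1 - e of p
-- from min and max are certified by a game that treats two intervals at once, so that each
-- ∀∃-round multiplies the certified distance by 4. All case distinctions (on digit values, on
-- which interval the ∀-player chose) are made in the matrix under one shared quantifier prefix,
-- so they do not multiply the number of quantifiers.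

open import Defs
open import Data.Bool using (Bool; true; false)
import Data.Bool.Properties as BP
open import Data.Empty using (⊥-elim)
open import Data.Fin as F using (Fin; toℕ; fromℕ<)
import Data.Fin.Properties as FP
open import Data.List using (List; []; _∷_; length; _++_; map; replicate)
open import Data.List.Membership.Propositional using (_∈_; _∉_)
open import Data.List.Properties using (++-assoc; ++-identityʳ; map-++; length-++; length-replicate)
open import Data.List.Relation.Unary.All using (All; []; _∷_)
open import Data.List.Relation.Unary.Any using (here; there)
open import Data.List.Relation.Unary.Unique.Propositional using (Unique)
open import Data.Maybe using (Maybe; just; nothing)
open import Data.Maybe.Properties using (just-injective)
open import Data.Nat
  using (ℕ; zero; suc; _+_; _*_; _∸_; _^_; _≤_; _<_; z≤n; s≤s; z<s; _≤?_; _<?_; ⌊_/2⌋; ⌈_/2⌉; _⊓_)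
open import Data.Nat using (NonZero; >-nonZero)
open import Data.Nat.DivMod using (_/_; _%_; m%n<n; m≡m%n+[m/n]*n; m<n*o⇒m/o<n; m/n*n≤m)
open import Data.Nat.Properties
open import Data.Nat.Tactic.RingSolver using (solve-∀)
open import Data.Product using (Σ; _×_; _,_; proj₁; proj₂; ∃)
open import Data.Product.Function.NonDependent.Propositional using (_×-⇔_)
open import Data.Sum using (_⊎_; inj₁; inj₂; [_,_]′)
open import Data.Sum.Function.Propositional using (_⊎-⇔_)
open import Data.Unit using (⊤; tt)
open import Data.Vec using (Vec; lookup; []; _∷_)
open import Data.Vec.Properties using (tabulate∘lookup; tabulate-cong)
open import Function using (_∘_; id; _⟨_⟩_)
open import Function.Bundles using (_⇔_; mk⇔; Equivalence)
open import Function.Properties.Equivalence using () renaming (trans to ⇔-trans)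
open import Relation.Binary.PropositionalEquality
open import Relation.Nullary using (¬_; Dec; yes; no; _×-dec_; _⊎-dec_; ¬?)

open Equivalence using (to; from)

private
  variable
    v : ℕ

⇔-≡ : ∀ {A B C : Set} → A ⇔ B → B ≡ C → A ⇔ C
⇔-≡ e refl = e

×-interchange : ∀ {A B C D : Set} → ((A × B) × (C × D)) ⇔ ((A × C) × (B × D))
×-interchange = mk⇔ (λ ((a , b) , (c , d)) → (a , c) , (b , d))
                    (λ ((a , c) , (b , d)) → (a , b) , (c , d))

infix  9 _≐₀_ _≺₀_ _≤₀_
infix  8 ¬₀_
infixr 7 _∧₀_
infixr 6 _∨₀_

data QF (v : ℕ) : Set where
  _≐₀_ _≺₀_ : Term v → Term v → QF v
  S₀        : Term v → QF v
  ¬₀_       : QF v → QF v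
  _∧₀_ _∨₀_ : QF v → QF v → QF v

⌜_⌝ : QF v → Formula v
⌜ s ≐₀ t ⌝ = s ≐ t
⌜ s ≺₀ t ⌝ = s ≺ t
⌜ S₀ t ⌝   = S t
⌜ ¬₀ g ⌝   = ¬' ⌜ g ⌝
⌜ g ∧₀ h ⌝ = ⌜ g ⌝ ∧' ⌜ h ⌝
⌜ g ∨₀ h ⌝ = ⌜ g ⌝ ∨' ⌜ h ⌝

qcount-⌜⌝ : (g : QF v) → qcount ⌜ g ⌝ ≡ 0
qcount-⌜⌝ (s ≐₀ t) = refl
qcount-⌜⌝ (s ≺₀ t) = refl
qcount-⌜⌝ (S₀ t)   = refl
qcount-⌜⌝ (¬₀ g)   = qcount-⌜⌝ g
qcount-⌜⌝ (g ∧₀ h) = cong₂ _+_ (qcount-⌜⌝ g) (qcount-⌜⌝ h)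
qcount-⌜⌝ (g ∨₀ h) = cong₂ _+_ (qcount-⌜⌝ g) (qcount-⌜⌝ h)

⊤₀ ⊥₀ : QF v
⊤₀ = tmin ≐₀ tmin
⊥₀ = ¬₀ ⊤₀

_≤₀_ : Term v → Term v → QF v
s ≤₀ t = (s ≺₀ t) ∨₀ (s ≐₀ t)

wkᵗ : Term v → Term (suc v)
wkᵗ (var i) = var (F.suc i)
wkᵗ tmin    = tmin
wkᵗ tmax    = tmax

wk₀ : QF v → QF (suc v)
wk₀ (s ≐₀ t) = wkᵗ s ≐₀ wkᵗ t
wk₀ (s ≺₀ t) = wkᵗ s ≺₀ wkᵗ t
wk₀ (S₀ t)   = S₀ (wkᵗ t)
wk₀ (¬₀ g)   = ¬₀ wk₀ g
wk₀ (g ∧₀ h) = wk₀ g ∧₀ wk₀ h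
wk₀ (g ∨₀ h) = wk₀ g ∨₀ wk₀ h

val : ∀ {m} → Env m v → Term v → ℕ
val ρ t = toℕ (evalT ρ t)

evalT-wkᵗ : ∀ {m} (ρ : Env m v) (a : Fin (suc m)) (t : Term v) →
  evalT (extend a ρ) (wkᵗ t) ≡ evalT ρ t
evalT-wkᵗ ρ a (var i) = refl
evalT-wkᵗ ρ a tmin    = refl
evalT-wkᵗ ρ a tmax    = refl

val-wkᵗ : ∀ {m} (ρ : Env m v) (a : Fin (suc m)) (t : Term v) → val (extend a ρ) (wkᵗ t) ≡ val ρ t
val-wkᵗ ρ a t = cong toℕ (evalT-wkᵗ ρ a t)

data Quantifier : Set where
  ∃Q ∀Q : Quantifier

Prefix : Set
Prefix = List Quantifier

depth : Prefix → ℕ → ℕ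
depth []        v = v
depth (_ ∷ pre) v = depth pre (suc v)

Prenex : Prefix → ℕ → Set
Prenex pre v = QF (depth pre v)

close : ∀ pre {v} → Prenex pre v → Formula v
close []         M = ⌜ M ⌝
close (∃Q ∷ pre) M = ∃' (close pre M)
close (∀Q ∷ pre) M = ∀' (close pre M)

qcount-close : ∀ pre {v} (M : Prenex pre v) → qcount (close pre M) ≡ length pre
qcount-close []         M = qcount-⌜⌝ M
qcount-close (∃Q ∷ pre) M = cong suc (qcount-close pre M)
qcount-close (∀Q ∷ pre) M = cong suc (qcount-close pre M)

lift : ∀ pre {v} → QF v → Prenex pre v
lift []        g = g
lift (_ ∷ pre) g = lift pre (wk₀ g)

ite : ∀ pre {v} → QF v → Prenex pre v → Prenex pre v → Prenex pre v
ite pre g φ ψ = (lift pre g ∧₀ φ) ∨₀ (¬₀ lift pre g ∧₀ ψ)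

guard : ∀ pre {v} → QF v → Prenex pre v → Prenex pre v
guard pre g φ = ite pre g φ ⊥₀

module Semantics {m : ℕ} (w : Vec Bool (suc m)) where

  infix 5 _⊨₀_ _⊨⟨_⟩_ _⊨₀?_

  _⊨₀_ : Env m v → QF v → Set
  ρ ⊨₀ g = Sat w ρ ⌜ g ⌝

  _⊨⟨_⟩_ : Env m v → ∀ pre → Prenex pre v → Set
  ρ ⊨⟨ pre ⟩ M = Sat w ρ (close pre M)

  ⊨₀-wk₀ : (ρ : Env m v) (a : Fin (suc m)) (g : QF v) → (extend a ρ ⊨₀ wk₀ g) ≡ (ρ ⊨₀ g)
  ⊨₀-wk₀ ρ a (s ≐₀ t) = cong₂ _≡_ (evalT-wkᵗ ρ a s) (evalT-wkᵗ ρ a t)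
  ⊨₀-wk₀ ρ a (s ≺₀ t) = cong₂ F._<_ (evalT-wkᵗ ρ a s) (evalT-wkᵗ ρ a t)
  ⊨₀-wk₀ ρ a (S₀ t)   = cong (λ i → lookup w i ≡ true) (evalT-wkᵗ ρ a t)
  ⊨₀-wk₀ ρ a (¬₀ g)   = cong ¬_ (⊨₀-wk₀ ρ a g)
  ⊨₀-wk₀ ρ a (g ∧₀ h) = cong₂ _×_ (⊨₀-wk₀ ρ a g) (⊨₀-wk₀ ρ a h)
  ⊨₀-wk₀ ρ a (g ∨₀ h) = cong₂ _⊎_ (⊨₀-wk₀ ρ a g) (⊨₀-wk₀ ρ a h)

  _⊨₀?_ : (ρ : Env m v) (g : QF v) → Dec (ρ ⊨₀ g)
  ρ ⊨₀? (s ≐₀ t) = evalT ρ s FP.≟ evalT ρ t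
  ρ ⊨₀? (s ≺₀ t) = evalT ρ s FP.<? evalT ρ t
  ρ ⊨₀? (S₀ t)   = lookup w (evalT ρ t) BP.≟ true
  ρ ⊨₀? (¬₀ g)   = ¬? (ρ ⊨₀? g)
  ρ ⊨₀? (g ∧₀ h) = ρ ⊨₀? g ×-dec ρ ⊨₀? h
  ρ ⊨₀? (g ∨₀ h) = ρ ⊨₀? g ⊎-dec ρ ⊨₀? h

  -- The hypothesis on σ says that σ extends ρ by values for the variables bound by pre.
  close-mono : ∀ pre {v} {ρ : Env m v} {M N : Prenex pre v} →
    (∀ {σ} → (∀ g → (σ ⊨₀ lift pre g) ≡ (ρ ⊨₀ g)) → σ ⊨₀ M → σ ⊨₀ N) →
    ρ ⊨⟨ pre ⟩ M → ρ ⊨⟨ pre ⟩ N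
  close-mono []         f = f (λ g → refl)
  close-mono (∃Q ∷ pre) {ρ = ρ} f (a , h) =
    a , close-mono pre (λ ext → f (λ g → trans (ext (wk₀ g)) (⊨₀-wk₀ ρ a g))) h
  close-mono (∀Q ∷ pre) {ρ = ρ} f h a =
    close-mono pre (λ ext → f (λ g → trans (ext (wk₀ g)) (⊨₀-wk₀ ρ a g))) (h a)

  ⊤₀-holds : ∀ pre {v} (ρ : Env m v) → ρ ⊨⟨ pre ⟩ ⊤₀
  ⊤₀-holds []         ρ = refl
  ⊤₀-holds (∃Q ∷ pre) ρ = F.zero , ⊤₀-holds pre _
  ⊤₀-holds (∀Q ∷ pre) ρ = λ a → ⊤₀-holds pre _

  ⊥₀-fails : ∀ pre {v} (ρ : Env m v) → ¬ ρ ⊨⟨ pre ⟩ ⊥₀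
  ⊥₀-fails []         ρ h       = h refl
  ⊥₀-fails (∃Q ∷ pre) ρ (a , h) = ⊥₀-fails pre _ h
  ⊥₀-fails (∀Q ∷ pre) ρ h       = ⊥₀-fails pre _ (h F.zero)

  module _ (pre : Prefix) {ρ : Env m v} {g : QF v} {φ : Prenex pre v} where

    ite-yes : ∀ {ψ} → ρ ⊨₀ g → ρ ⊨⟨ pre ⟩ ite pre g φ ψ ⇔ ρ ⊨⟨ pre ⟩ φ
    ite-yes hg = mk⇔
      (close-mono pre λ where ext (inj₁ (_ , h)) → h
                              ext (inj₂ (ng , _)) → ⊥-elim (ng (subst id (sym (ext g)) hg)))
      (close-mono pre λ ext h → inj₁ (subst id (sym (ext g)) hg , h))

    ite-no : ∀ {ψ} → ¬ ρ ⊨₀ g → ρ ⊨⟨ pre ⟩ ite pre g φ ψ ⇔ ρ ⊨⟨ pre ⟩ ψ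
    ite-no ng = mk⇔
      (close-mono pre λ where ext (inj₁ (hg , _)) → ⊥-elim (ng (subst id (ext g) hg))
                              ext (inj₂ (_ , h)) → h)
      (close-mono pre λ ext h → inj₂ (ng ∘ subst id (ext g) , h))

    ite-sem : ∀ {ψ} →
      ρ ⊨⟨ pre ⟩ ite pre g φ ψ ⇔ ((ρ ⊨₀ g → ρ ⊨⟨ pre ⟩ φ) × (¬ ρ ⊨₀ g → ρ ⊨⟨ pre ⟩ ψ))
    ite-sem with ρ ⊨₀? g
    ... | yes hg = mk⇔ (λ h → (λ _ → to (ite-yes hg) h) , λ ng → ⊥-elim (ng hg))
                       (λ (hφ , _) → from (ite-yes hg) (hφ hg))
    ... | no ng  = mk⇔ (λ h → (λ hg → ⊥-elim (ng hg)) , λ _ → to (ite-no ng) h)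
                       (λ (_ , hψ) → from (ite-no ng) (hψ ng))

    guard-sem : ρ ⊨⟨ pre ⟩ guard pre g φ ⇔ (ρ ⊨₀ g × ρ ⊨⟨ pre ⟩ φ)
    guard-sem with ρ ⊨₀? g
    ... | yes hg = mk⇔ (λ h → hg , to (ite-yes hg) h) (λ (_ , h) → from (ite-yes hg) h)
    ... | no ng  = mk⇔ (λ h → ⊥-elim (⊥₀-fails pre ρ (to (ite-no ng) h)))
                       (λ (hg , _) → ⊥-elim (ng hg))

game : ℕ → Prefix
game zero    = []
game (suc k) = ∀Q ∷ ∃Q ∷ game k

length-game : ∀ k → length (game k) ≡ k + k
length-game zero    = refl
length-game (suc k) = cong suc (trans (cong suc (length-game k)) (sym (+-suc k k)))

-- reach k = (2 * 4 ^ k + 1) / 3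
reach : ℕ → ℕ
reach zero    = 1
reach (suc k) = 4 * reach k ∸ 1

reach-pos : ∀ k → 1 ≤ reach k
reach-pos zero    = s≤s z≤n
reach-pos (suc k) = ≤-trans (s≤s z≤n) (∸-monoˡ-≤ 1 (*-monoʳ-≤ 4 (reach-pos k)))

left right : ℕ → ℕ
left  L = ⌊ suc L /2⌋
right L = ⌈ suc L /2⌉

left+right : ∀ L → left L + right L ≡ suc L
left+right L = ⌊n/2⌋+⌈n/2⌉≡n (suc L)

⌈n/2⌉+⌊n/2⌋≡n : ∀ n → ⌈ n /2⌉ + ⌊ n /2⌋ ≡ n
⌈n/2⌉+⌊n/2⌋≡n n = trans (+-comm ⌈ n /2⌉ ⌊ n /2⌋) (⌊n/2⌋+⌈n/2⌉≡n n)

⌈right/2⌉≤reach : ∀ k L → L ≤ reach (suc k) → ⌈ right L /2⌉ ≤ reach k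
⌈right/2⌉≤reach k L L≤ = begin
  ⌈ right L /2⌉               ≤⟨ ⌈n/2⌉-mono right≤ ⟩
  ⌈ reach k + reach k /2⌉     ≡⟨ sym (n≡⌈n+n/2⌉ (reach k)) ⟩
  reach k                     ∎
  where
  open ≤-Reasoning
  r = reach k
  1+L≤ : suc L ≤ 2 * r + 2 * r
  1+L≤ = begin
    suc L              ≤⟨ s≤s L≤ ⟩
    suc (4 * r ∸ 1)    ≡⟨ +-comm 1 (4 * r ∸ 1) ⟩
    4 * r ∸ 1 + 1      ≡⟨ m∸n+n≡m (≤-trans (reach-pos k) (m≤n*m r 4)) ⟩
    4 * r              ≡⟨ *-distribʳ-+ r 2 2 ⟩
    2 * r + 2 * r      ∎
  right≤ : right L ≤ r + r
  right≤ = begin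
    ⌈ suc L /2⌉             ≤⟨ ⌈n/2⌉-mono 1+L≤ ⟩
    ⌈ 2 * r + 2 * r /2⌉     ≡⟨ sym (n≡⌈n+n/2⌉ (2 * r)) ⟩
    2 * r                   ≡⟨ cong (r +_) (+-identityʳ r) ⟩
    r + r                   ∎

quarters≤reach : ∀ k L → L ≤ reach (suc k) →
  (⌈ left L /2⌉ ≤ reach k × ⌊ left L /2⌋ ≤ reach k) × (⌈ right L /2⌉ ≤ reach k × ⌊ right L /2⌋ ≤ reach k)
quarters≤reach k L L≤ =
  (⌈left/2⌉≤ , ≤-trans (⌊n/2⌋≤⌈n/2⌉ (left L)) ⌈left/2⌉≤) ,
  (⌈right/2⌉≤ , ≤-trans (⌊n/2⌋≤⌈n/2⌉ (right L)) ⌈right/2⌉≤)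
  where
  ⌈right/2⌉≤ = ⌈right/2⌉≤reach k L L≤
  ⌈left/2⌉≤ = ≤-trans (⌈n/2⌉-mono (⌊n/2⌋≤⌈n/2⌉ (suc L))) ⌈right/2⌉≤

Gap₀ : ℕ → ℕ → ℕ → Set
Gap₀ zero    X Y = X ≤ Y
Gap₀ (suc _) X Y = X < Y

Gap₀-of-≤ : ∀ L {X Y} → X + L ≤ Y → Gap₀ L X Y
Gap₀-of-≤ zero    {X} le = ≤-trans (m≤m+n X 0) le
Gap₀-of-≤ (suc L) {X} le = <-≤-trans (m<m+n X z<s) le

≤-of-Gap₀ : ∀ L {X Y} → L ≤ 1 → Gap₀ L X Y → X + L ≤ Y
≤-of-Gap₀ zero          {X} {Y} _ g = subst (_≤ Y) (sym (+-identityʳ X)) g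
≤-of-Gap₀ (suc zero)    {X} {Y} _ g = subst (_≤ Y) (+-comm 1 X) g
≤-of-Gap₀ (suc (suc L)) (s≤s ())

Splits : ℕ → ℕ → ℕ → ℕ → Set
Splits L X U Y = X + left L ≤ U ⊎ U + right L ≤ Y

splits-of-gap : ∀ L X Y U → X + L ≤ Y → Splits L X U Y
splits-of-gap L X Y U le with X + left L ≤? U
... | yes p = inj₁ p
... | no np = inj₂ (≤-pred (begin
  suc U + right L       ≤⟨ +-monoˡ-≤ (right L) (≰⇒> np) ⟩
  X + left L + right L  ≡⟨ +-assoc X (left L) (right L) ⟩
  X + (left L + right L) ≡⟨ cong (X +_) (left+right L) ⟩
  X + suc L             ≡⟨ +-suc X L ⟩
  suc (X + L)           ≤⟨ s≤s le ⟩
  suc Y                 ∎))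
  where open ≤-Reasoning

-- Probe with U = X + left L - 1 if that lies below Y, and with U = X otherwise.
gap-of-splits : ∀ L X Y → Gap₀ L X Y → (∀ U → X ≤ U → U < Y → Splits L X U Y) → X + L ≤ Y
gap-of-splits zero    X Y g H = ≤-of-Gap₀ zero z≤n g
gap-of-splits (suc L) X Y g H = cases (X + left (suc L) ≤? Y)
  where
  a = ⌊ L /2⌋
  cases : Dec (X + suc a ≤ Y) → X + suc L ≤ Y
  cases (yes le) =
    [ (λ q → ⊥-elim (<-irrefl refl (subst (_≤ X + a) (+-suc X a) q)))
    , (λ q → subst (_≤ Y) (trans (+-assoc X a _) (cong (X +_) (suc-injective (left+right (suc L))))) q)
    ]′ (H (X + a) (m≤m+n X a) (subst (_≤ Y) (+-suc X a) le))
  cases (no nle) =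
    [ (λ q → ⊥-elim (m+1+n≰m X q))
    , (λ q → ⊥-elim (<⇒≱ (+-cancelˡ-< X _ _ (≤-<-trans q (≰⇒> nle))) (⌊n/2⌋≤⌈n/2⌉ (suc (suc L)))))
    ]′ (H X ≤-refl g)

toℕ-onto : ∀ {m} N → N < suc m → Σ (Fin (suc m)) λ z → toℕ z ≡ N
toℕ-onto N N<n = fromℕ< N<n , FP.toℕ-fromℕ< N<n

AllSplit : ℕ → ℕ → ℕ → ℕ → Set
AllSplit m L X Y = ∀ (u : Fin (suc m)) → X ≤ toℕ u × toℕ u < Y → Splits L X (toℕ u) Y

gap⇔splits : ∀ {m} L X Y → Y < suc m → (Gap₀ L X Y × AllSplit m L X Y) ⇔ X + L ≤ Y
gap⇔splits L X Y Y<n = mk⇔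
  (λ (g , H) → gap-of-splits L X Y g λ U X≤U U<Y →
     let (u , u≡U) = toℕ-onto U (<-trans U<Y Y<n) in
     subst (λ U → Splits L X U Y) u≡U (H u (subst (λ U → X ≤ U × U < Y) (sym u≡U) (X≤U , U<Y))))
  (λ le → Gap₀-of-≤ L le , λ u _ → splits-of-gap L X Y (toℕ u) le)

gap-trans : ∀ {X Z W} a b → X + a ≤ Z → Z + b ≤ W → X + (a + b) ≤ W
gap-trans {X} a b p q = ≤-trans (≤-reflexive (sym (+-assoc X a b))) (≤-trans (+-monoˡ-≤ b p) q)

cut : ∀ {m} X a b Y → Y < suc m → X + (a + b) ≤ Y →
  Σ (Fin (suc m)) λ c → toℕ c ≡ X + a × toℕ c + b ≤ Y
cut X a b Y Y<n le =
  let (c , c≡) = toℕ-onto (X + a) (≤-<-trans (≤-trans (+-monoʳ-≤ X (m≤m+n a b)) le) Y<n)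
  in c , c≡ , subst (_≤ Y) (sym (trans (cong (_+ b) c≡) (+-assoc X a b))) le

gap₀ : ℕ → Term v → Term v → QF v
gap₀ zero    x y = x ≤₀ y
gap₀ (suc _) x y = x ≺₀ y

inside : Term v → Term v → Term v → QF v
inside x u y = x ≤₀ u ∧₀ u ≺₀ y

-- In a round the ∀-player picks a point u in one of the two disjoint intervals, and the
-- ∃-player answers with a point z halving the long side of u; this leaves two intervals for the
-- next round. Since one round serves both intervals, two quantifiers quadruple the length that
-- can be certified (see reach).
mutual
  bothGaps : ∀ k → ℕ → Term v → Term v → ℕ → Term v → Term v → Prenex (game k) v
  bothGaps zero    L₁ x₁ y₁ L₂ x₂ y₂ = gap₀ L₁ x₁ y₁ ∧₀ gap₀ L₂ x₂ y₂
  bothGaps (suc k) L₁ x₁ y₁ L₂ x₂ y₂ =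
    guard (game (suc k)) (gap₀ L₁ x₁ y₁ ∧₀ gap₀ L₂ x₂ y₂) (round k L₁ x₁ y₁ L₂ x₂ y₂)

  round : ∀ k → ℕ → Term v → Term v → ℕ → Term v → Term v → Prenex (game (suc k)) v
  round k L₁ x₁ y₁ L₂ x₂ y₂ =
    ite (∃Q ∷ game k) (inside (wkᵗ x₁) u (wkᵗ y₁)) (splitAt k L₁ (wkᵗ x₁) (wkᵗ y₁) u)
      (ite (∃Q ∷ game k) (inside (wkᵗ x₂) u (wkᵗ y₂)) (splitAt k L₂ (wkᵗ x₂) (wkᵗ y₂) u) ⊤₀)
    where u = var F.zero

  splitAt : ∀ k → ℕ → Term v → Term v → Term v → Prenex (∃Q ∷ game k) v
  splitAt k L x y u =
    ite (game k) (z ≤₀ wkᵗ u)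
      (bothGaps k ⌈ left L /2⌉ (wkᵗ x) z ⌊ left L /2⌋ z (wkᵗ u))
      (bothGaps k ⌈ right L /2⌉ (wkᵗ u) z ⌊ right L /2⌋ z (wkᵗ y))
    where z = var F.zero

module GameSemantics {m : ℕ} (w : Vec Bool (suc m)) where
  open Semantics w

  ≤₀-sem : (ρ : Env m v) (s t : Term v) → ρ ⊨₀ s ≤₀ t ⇔ val ρ s ≤ val ρ t
  ≤₀-sem ρ s t = mk⇔
    (λ where (inj₁ lt) → <⇒≤ lt
             (inj₂ eq) → ≤-reflexive (cong toℕ eq))
    (λ le → [ inj₁ , inj₂ ∘ FP.toℕ-injective ]′ (m≤n⇒m<n∨m≡n le))

  gap₀-sem : ∀ L (ρ : Env m v) x y → ρ ⊨₀ gap₀ L x y ⇔ Gap₀ L (val ρ x) (val ρ y)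
  gap₀-sem zero    ρ x y = ≤₀-sem ρ x y
  gap₀-sem (suc L) ρ x y = mk⇔ id id

  inside-sem : (ρ : Env m v) (x u y : Term v) →
    ρ ⊨₀ inside x u y ⇔ (val ρ x ≤ val ρ u × val ρ u < val ρ y)
  inside-sem ρ x u y = ≤₀-sem ρ x u ×-⇔ mk⇔ id id

  mutual
    bothGaps-sem : ∀ k (ρ : Env m v) L₁ x₁ y₁ L₂ x₂ y₂ → L₁ ≤ reach k → L₂ ≤ reach k →
      val ρ y₁ ≤ val ρ x₂ →
      ρ ⊨⟨ game k ⟩ bothGaps k L₁ x₁ y₁ L₂ x₂ y₂ ⇔ (val ρ x₁ + L₁ ≤ val ρ y₁ × val ρ x₂ + L₂ ≤ val ρ y₂)
    bothGaps-sem zero ρ L₁ x₁ y₁ L₂ x₂ y₂ L₁≤ L₂≤ _ =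
      (gap₀-sem L₁ ρ x₁ y₁ ×-⇔ gap₀-sem L₂ ρ x₂ y₂)
        ⟨ ⇔-trans ⟩ (mk⇔ (≤-of-Gap₀ L₁ L₁≤) (Gap₀-of-≤ L₁) ×-⇔ mk⇔ (≤-of-Gap₀ L₂ L₂≤) (Gap₀-of-≤ L₂))
    bothGaps-sem (suc k) ρ L₁ x₁ y₁ L₂ x₂ y₂ L₁≤ L₂≤ y₁≤x₂ =
      guard-sem (game (suc k))
        ⟨ ⇔-trans ⟩ ((gap₀-sem L₁ ρ x₁ y₁ ×-⇔ gap₀-sem L₂ ρ x₂ y₂)
                       ×-⇔ round-sem k ρ L₁ x₁ y₁ L₂ x₂ y₂ L₁≤ L₂≤ y₁≤x₂)
        ⟨ ⇔-trans ⟩ ×-interchange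
        ⟨ ⇔-trans ⟩ (gap⇔splits L₁ _ _ (FP.toℕ<n _) ×-⇔ gap⇔splits L₂ _ _ (FP.toℕ<n _))

    round-sem : ∀ k (ρ : Env m v) L₁ x₁ y₁ L₂ x₂ y₂ → L₁ ≤ reach (suc k) → L₂ ≤ reach (suc k) →
      val ρ y₁ ≤ val ρ x₂ → ρ ⊨⟨ game (suc k) ⟩ round k L₁ x₁ y₁ L₂ x₂ y₂ ⇔
        (AllSplit m L₁ (val ρ x₁) (val ρ y₁) × AllSplit m L₂ (val ρ x₂) (val ρ y₂))
    round-sem k ρ L₁ x₁ y₁ L₂ x₂ y₂ L₁≤ L₂≤ y₁≤x₂ = mk⇔ forward backward
      where
      pre = ∃Q ∷ game k
      u₀ = var F.zero
      In : ∀ x y (u : Fin (suc m)) →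
        extend u ρ ⊨₀ inside (wkᵗ x) u₀ (wkᵗ y) ⇔ (val ρ x ≤ toℕ u × toℕ u < val ρ y)
      In x y u = ⇔-≡ (inside-sem (extend u ρ) (wkᵗ x) u₀ (wkᵗ y))
                     (cong₂ (λ X Y → X ≤ toℕ u × toℕ u < Y) (val-wkᵗ ρ u x) (val-wkᵗ ρ u y))
      Split : ∀ L x y → L ≤ reach (suc k) → (u : Fin (suc m)) →
        extend u ρ ⊨⟨ pre ⟩ splitAt k L (wkᵗ x) (wkᵗ y) u₀ ⇔ Splits L (val ρ x) (toℕ u) (val ρ y)
      Split L x y L≤ u = ⇔-≡ (splitAt-sem k (extend u ρ) L (wkᵗ x) (wkᵗ y) u₀ L≤)
                             (cong₂ (λ X Y → Splits L X (toℕ u) Y) (val-wkᵗ ρ u x) (val-wkᵗ ρ u y))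
      forward : ρ ⊨⟨ game (suc k) ⟩ round k L₁ x₁ y₁ L₂ x₂ y₂ →
        AllSplit m L₁ (val ρ x₁) (val ρ y₁) × AllSplit m L₂ (val ρ x₂) (val ρ y₂)
      forward h = all₁ , all₂
        where
        all₁ : AllSplit m L₁ (val ρ x₁) (val ρ y₁)
        all₁ u u∈₁ = to (Split L₁ x₁ y₁ L₁≤ u) (proj₁ (to (ite-sem pre) (h u)) (from (In x₁ y₁ u) u∈₁))
        all₂ : AllSplit m L₂ (val ρ x₂) (val ρ y₂)
        all₂ u u∈₂@(X₂≤u , _) =
          let u∉₁ = λ i₁ → <⇒≱ (proj₂ (to (In x₁ y₁ u) i₁)) (≤-trans y₁≤x₂ X₂≤u)
              h₂ = proj₂ (to (ite-sem pre) (h u)) u∉₁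
          in to (Split L₂ x₂ y₂ L₂≤ u) (proj₁ (to (ite-sem pre) h₂) (from (In x₂ y₂ u) u∈₂))
      backward : AllSplit m L₁ (val ρ x₁) (val ρ y₁) × AllSplit m L₂ (val ρ x₂) (val ρ y₂) →
        ρ ⊨⟨ game (suc k) ⟩ round k L₁ x₁ y₁ L₂ x₂ y₂
      backward (all₁ , all₂) u = from (ite-sem pre)
        ( (λ i₁ → from (Split L₁ x₁ y₁ L₁≤ u) (all₁ u (to (In x₁ y₁ u) i₁)))
        , λ _ → from (ite-sem pre)
            ( (λ i₂ → from (Split L₂ x₂ y₂ L₂≤ u) (all₂ u (to (In x₂ y₂ u) i₂)))
            , λ _ → ⊤₀-holds pre _))

    splitAt-sem : ∀ k (ρ : Env m v) L x y u → L ≤ reach (suc k) →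
      ρ ⊨⟨ ∃Q ∷ game k ⟩ splitAt k L x y u ⇔ Splits L (val ρ x) (val ρ u) (val ρ y)
    splitAt-sem k ρ L x y u L≤ = mk⇔ forward backward
      where
      X = val ρ x
      Y = val ρ y
      U = val ρ u
      a₁ = ⌈ left L /2⌉
      a₂ = ⌊ left L /2⌋
      b₁ = ⌈ right L /2⌉
      b₂ = ⌊ right L /2⌋
      z = var F.zero
      a₁≤ = proj₁ (proj₁ (quarters≤reach k L L≤))
      a₂≤ = proj₂ (proj₁ (quarters≤reach k L L≤))
      b₁≤ = proj₁ (proj₂ (quarters≤reach k L L≤))
      b₂≤ = proj₂ (proj₂ (quarters≤reach k L L≤))
      below : ∀ c → extend c ρ ⊨₀ z ≤₀ wkᵗ u ⇔ toℕ c ≤ U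
      below c = ⇔-≡ (≤₀-sem (extend c ρ) z (wkᵗ u)) (cong (toℕ c ≤_) (val-wkᵗ ρ c u))
      leftGaps : ∀ c → extend c ρ ⊨⟨ game k ⟩ bothGaps k a₁ (wkᵗ x) z a₂ z (wkᵗ u) ⇔
                         (X + a₁ ≤ toℕ c × toℕ c + a₂ ≤ U)
      leftGaps c =
        ⇔-≡ (bothGaps-sem k (extend c ρ) a₁ (wkᵗ x) z a₂ z (wkᵗ u) a₁≤ a₂≤ ≤-refl)
            (cong₂ (λ X U → X + a₁ ≤ toℕ c × toℕ c + a₂ ≤ U) (val-wkᵗ ρ c x) (val-wkᵗ ρ c u))
      rightGaps : ∀ c → extend c ρ ⊨⟨ game k ⟩ bothGaps k b₁ (wkᵗ u) z b₂ z (wkᵗ y) ⇔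
                          (U + b₁ ≤ toℕ c × toℕ c + b₂ ≤ Y)
      rightGaps c =
        ⇔-≡ (bothGaps-sem k (extend c ρ) b₁ (wkᵗ u) z b₂ z (wkᵗ y) b₁≤ b₂≤ ≤-refl)
            (cong₂ (λ U Y → U + b₁ ≤ toℕ c × toℕ c + b₂ ≤ Y) (val-wkᵗ ρ c u) (val-wkᵗ ρ c y))
      forward : ρ ⊨⟨ ∃Q ∷ game k ⟩ splitAt k L x y u → Splits L X U Y
      forward (c , h) with toℕ c ≤? U | to (ite-sem (game k)) h
      ... | yes c≤U | (hl , _) =
        let (p , q) = to (leftGaps c) (hl (from (below c) c≤U))
        in inj₁ (subst (λ s → X + s ≤ U) (⌈n/2⌉+⌊n/2⌋≡n (left L)) (gap-trans a₁ a₂ p q))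
      ... | no c≰U  | (_ , hr) =
        let (p , q) = to (rightGaps c) (hr (c≰U ∘ to (below c)))
        in inj₂ (subst (λ s → U + s ≤ Y) (⌈n/2⌉+⌊n/2⌋≡n (right L)) (gap-trans b₁ b₂ p q))
      backward : Splits L X U Y → ρ ⊨⟨ ∃Q ∷ game k ⟩ splitAt k L x y u
      backward (inj₁ le) =
        let (c , c≡ , c+a₂≤) =
              cut X a₁ a₂ U (FP.toℕ<n _) (subst (λ s → X + s ≤ U) (sym (⌈n/2⌉+⌊n/2⌋≡n (left L))) le)
        in c , from (ite-yes (game k) (from (below c) (≤-trans (m≤m+n _ a₂) c+a₂≤)))
                 (from (leftGaps c) (≤-reflexive (sym c≡) , c+a₂≤))
      backward (inj₂ le) =
        let (c , c≡ , c+b₂≤) =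
              cut U b₁ b₂ Y (FP.toℕ<n _) (subst (λ s → U + s ≤ Y) (sym (⌈n/2⌉+⌊n/2⌋≡n (right L))) le)
        in c , from (ite-no (game k) λ h → <⇒≱ (subst (U <_) (sym c≡) (m<m+n U z<s)) (to (below c) h))
                 (from (rightGaps c) (≤-reflexive (sym c≡) , c+b₂≤))

isPosition : ∀ k m e → Term v → Prenex (game k) v
isPosition k m e p = bothGaps k e tmin p (m ∸ e) p tmax

lit : Bool → Term v → QF v
lit true  p = S₀ p
lit false p = ¬₀ S₀ p

agreesAt : ∀ k m → Maybe (Vec Bool (suc m)) → ℕ → Term v → Prenex (game k) v
agreesAt k m nothing  e p = ⊥₀
agreesAt k m (just u) e p with e <? suc m
... | yes e<n = guard (game k) (lit (lookup u (fromℕ< e<n)) p) (isPosition k m e p)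
... | no _    = ⊥₀

module PositionSemantics {m : ℕ} (w : Vec Bool (suc m)) where
  open Semantics w
  open GameSemantics w

  isPosition-sem : ∀ k e (ρ : Env m v) p → e ≤ m → m ≤ reach k →
    ρ ⊨⟨ game k ⟩ isPosition k m e p ⇔ val ρ p ≡ e
  isPosition-sem k e ρ p e≤m m≤reach =
    bothGaps-sem k ρ e tmin p (m ∸ e) p tmax (≤-trans e≤m m≤reach) (≤-trans (m∸n≤m m e) m≤reach) ≤-refl
      ⟨ ⇔-trans ⟩ mk⇔
        (λ (e≤P , P+d≤m) → ≤-antisym (+-cancelʳ-≤ (m ∸ e) _ _ (≤-trans P+d≤m (≤-reflexive max≡))) e≤P)
        (λ P≡e → ≤-reflexive (sym P≡e) , ≤-reflexive (trans (cong (_+ (m ∸ e)) P≡e) (sym max≡)))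
    where
    max≡ : val ρ tmax ≡ e + (m ∸ e)
    max≡ = trans (FP.toℕ-fromℕ m) (sym (m+[n∸m]≡n e≤m))

  lit-sem : ∀ b (ρ : Env m v) p → ρ ⊨₀ lit b p ⇔ lookup w (evalT ρ p) ≡ b
  lit-sem true  ρ p = mk⇔ id id
  lit-sem false ρ p = mk⇔ BP.¬-not BP.not-¬

  agreesAt-sound : ∀ k mu e (ρ : Env m v) p → m ≤ reach k → ρ ⊨⟨ game k ⟩ agreesAt k m mu e p →
    Σ (Vec Bool (suc m)) λ u → mu ≡ just u × lookup w (evalT ρ p) ≡ lookup u (evalT ρ p)
  agreesAt-sound k nothing  e ρ p _ h = ⊥-elim (⊥₀-fails (game k) ρ h)
  agreesAt-sound k (just u) e ρ p m≤reach h with e <? suc m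
  ... | no _    = ⊥-elim (⊥₀-fails (game k) ρ h)
  ... | yes e<n = u , refl , trans (to (lit-sem _ ρ p) letter) (cong (lookup u) e≡p)
    where
    letter = proj₁ (to (guard-sem (game k)) h)
    e≡p : fromℕ< e<n ≡ evalT ρ p
    e≡p = FP.toℕ-injective (trans (FP.toℕ-fromℕ< e<n)
            (sym (to (isPosition-sem k e ρ p (≤-pred e<n) m≤reach) (proj₂ (to (guard-sem (game k)) h)))))

  agreesAt-complete : ∀ k mu e (ρ : Env m v) p → mu ≡ just w → m ≤ reach k → val ρ p ≡ e →
    ρ ⊨⟨ game k ⟩ agreesAt k m mu e p
  agreesAt-complete k .(just w) e ρ p refl m≤reach P≡e with e <? suc m
  ... | no e≮n  = ⊥-elim (e≮n (subst (_< suc m) P≡e (FP.toℕ<n _)))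
  ... | yes e<n = from (guard-sem (game k))
    ( from (lit-sem _ ρ p) (cong (lookup w) (FP.toℕ-injective (trans P≡e (sym (FP.toℕ-fromℕ< e<n)))))
    , from (isPosition-sem k e ρ p (≤-pred e<n) m≤reach) P≡e)

caseOn : ∀ pre {v} → Term v → List (Term v) → (ℕ → Prenex pre v) → Prenex pre v
caseOn pre d []       F = ⊥₀
caseOn pre d (r ∷ rs) F = ite pre (d ≐₀ r) (F 0) (caseOn pre d rs (F ∘ suc))

DigitsCont : Prefix → ℕ → Set
DigitsCont pre v = ∀ {v′} → (Term v → Term v′) → List ℕ → Prenex pre v′

-- Binds t variables, each required to equal one of rs; K receives a weakening into its context
-- and, in binding order, the index of the first term of rs that each variable equals.

readDigits : ∀ pre t {v} → List (Term v) → DigitsCont pre v → Prenex (replicate t ∃Q ++ pre) v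
readDigits pre zero    rs K = K id []
readDigits pre (suc t) rs K =
  caseOn (replicate t ∃Q ++ pre) (var F.zero) (map wkᵗ rs) λ j →
    readDigits pre t (map wkᵗ rs) λ wk ds → K (wk ∘ wkᵗ) (j ∷ ds)

TermsCont : Prefix → Set
TermsCont pre = ∀ {v′} → List (Term v′) → Prenex pre v′

guessTerms : ∀ pre r {v} → List (Term v) → TermsCont pre → Prenex (replicate r ∃Q ++ pre) v
guessTerms pre zero    ts K = K ts
guessTerms pre (suc r) ts K = guessTerms pre r (map wkᵗ ts ++ var F.zero ∷ []) K

Consecutive : ∀ {m} → ℕ → List (Fin (suc m)) → Set
Consecutive s []       = ⊤
Consecutive s (a ∷ as) = toℕ a ≡ s × Consecutive (suc s) as

consecutive : ∀ {m} s r → s + r ≤ suc m → Σ (List (Fin (suc m))) λ as → length as ≡ r × Consecutive s as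
consecutive s zero    _  = [] , refl , tt
consecutive {m} s (suc r) le =
  let (as , len , cons) = consecutive (suc s) r (subst (_≤ suc m) (+-suc s r) le)
      (a , a≡s) = toℕ-onto s (<-≤-trans (m<m+n s z<s) le)
  in a ∷ as , cong suc len , a≡s , cons

Consecutive-< : ∀ {m} s j (as : List (Fin (suc m))) → Consecutive s as → j < length as → s + j < suc m
Consecutive-< {m} s zero    (a ∷ as) (a≡s , _)  _ =
  subst (_< suc m) (trans a≡s (sym (+-identityʳ s))) (FP.toℕ<n a)
Consecutive-< {m} s (suc j) (a ∷ as) (_ , cons) (s≤s j<) =
  subst (_< suc m) (sym (+-suc s j)) (Consecutive-< (suc s) j as cons j<)

record Extension {m v} (ρ : Env m v) : Set where
  field
    {dim} : ℕ
    env   : Env m dim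
    embed : Term v → Term dim
    agree : ∀ t → evalT env (embed t) ≡ evalT ρ t

open Extension

module _ {m : ℕ} where

  extension-refl : (ρ : Env m v) → Extension ρ
  extension-refl ρ = record { env = ρ ; embed = id ; agree = λ _ → refl }

  extension-wkᵗ : (ρ : Env m v) (a : Fin (suc m)) → Extension ρ
  extension-wkᵗ ρ a = record { env = extend a ρ ; embed = wkᵗ ; agree = evalT-wkᵗ ρ a }

  infixl 5 _⨾_
  _⨾_ : {ρ : Env m v} (e : Extension ρ) → Extension (env e) → Extension ρ
  e ⨾ e′ = record
    { env = env e′ ; embed = embed e′ ∘ embed e ; agree = λ t → trans (agree e′ (embed e t)) (agree e t) }

  map-agree : {ρ : Env m v} (e : Extension ρ) (ts : List (Term v)) →
    map (evalT (env e)) (map (embed e) ts) ≡ map (evalT ρ) ts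
  map-agree e []       = refl
  map-agree e (t ∷ ts) = cong₂ _∷_ (agree e t) (map-agree e ts)

module ReadingSemantics {m : ℕ} (w : Vec Bool (suc m)) where
  open Semantics w

  caseOn-sound : ∀ pre (ρ : Env m v) d rs F → ρ ⊨⟨ pre ⟩ caseOn pre d rs F → ∃ λ j → ρ ⊨⟨ pre ⟩ F j
  caseOn-sound pre ρ d []       F h = ⊥-elim (⊥₀-fails pre ρ h)
  caseOn-sound pre ρ d (r ∷ rs) F h with ρ ⊨₀? (d ≐₀ r)
  ... | yes d≡r = 0 , to (ite-yes pre d≡r) h
  ... | no d≢r  = let (j , hj) = caseOn-sound pre ρ d rs (F ∘ suc) (to (ite-no pre d≢r) h) in suc j , hj

  caseOn-complete : ∀ pre (ρ : Env m v) d rs F s j →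
    Consecutive s (map (evalT ρ) rs) → j < length (map (evalT ρ) rs) → val ρ d ≡ s + j →
    ρ ⊨⟨ pre ⟩ F j → ρ ⊨⟨ pre ⟩ caseOn pre d rs F
  caseOn-complete pre ρ d (r ∷ rs) F s zero (r≡s , _) _ d≡s h =
    from (ite-yes pre (FP.toℕ-injective (trans d≡s (trans (+-identityʳ s) (sym r≡s))))) h
  caseOn-complete pre ρ d (r ∷ rs) F s (suc j) (r≡s , cons) (s≤s j<) d≡s h =
    from (ite-no pre (λ d≡r → m+1+n≰m s (≤-reflexive (trans (sym d≡s) (trans (cong toℕ d≡r) r≡s)))))
      (caseOn-complete pre ρ d rs (F ∘ suc) (suc s) j cons j< (trans d≡s (+-suc s j)) h)

  readDigits-sound : ∀ pre t (ρ : Env m v) rs (K : DigitsCont pre v) →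
    ρ ⊨⟨ replicate t ∃Q ++ pre ⟩ readDigits pre t rs K →
    Σ (Extension ρ) λ e → ∃ λ ds → env e ⊨⟨ pre ⟩ K (embed e) ds
  readDigits-sound pre zero    ρ rs K h = extension-refl ρ , [] , h
  readDigits-sound pre (suc t) ρ rs K (a , h) =
    let (j , hj) = caseOn-sound (replicate t ∃Q ++ pre) (extend a ρ) (var F.zero) (map wkᵗ rs) _ h
        (e , ds , he) = readDigits-sound pre t (extend a ρ) (map wkᵗ rs) _ hj
    in extension-wkᵗ ρ a ⨾ e , j ∷ ds , he

  readDigits-complete : ∀ pre t (ρ : Env m v) rs (K : DigitsCont pre v) vals →
    map (evalT ρ) rs ≡ vals → Consecutive 0 vals → ∀ ds → length ds ≡ t → All (_< length vals) ds →
    (∀ (e : Extension ρ) → env e ⊨⟨ pre ⟩ K (embed e) ds) → ρ ⊨⟨ replicate t ∃Q ++ pre ⟩ readDigits pre t rs K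
  readDigits-complete pre zero    ρ rs K vals eq cons [] refl [] H = H (extension-refl ρ)
  readDigits-complete pre (suc t) ρ rs K vals eq cons (j ∷ ds) len (j< ∷ ds<) H =
    let (a , a≡j) = toℕ-onto j (Consecutive-< 0 j vals cons j<)
        eq′ = trans (map-agree (extension-wkᵗ ρ a) rs) eq
    in a , caseOn-complete (replicate t ∃Q ++ pre) (extend a ρ) (var F.zero) (map wkᵗ rs) _ 0 j
             (subst (Consecutive 0) (sym eq′) cons) (subst (λ vs → j < length vs) (sym eq′) j<) a≡j
             (readDigits-complete pre t (extend a ρ) (map wkᵗ rs) _ vals eq′ cons ds (suc-injective len) ds<
                (λ e → H (extension-wkᵗ ρ a ⨾ e)))

  guessTerms-sound : ∀ pre r (ρ : Env m v) ts (K : TermsCont pre) →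
    ρ ⊨⟨ replicate r ∃Q ++ pre ⟩ guessTerms pre r ts K →
    ∃ λ v′ → Σ (Env m v′) λ ρ′ → ∃ λ ts′ → ρ′ ⊨⟨ pre ⟩ K ts′
  guessTerms-sound pre zero    ρ ts K h       = _ , ρ , ts , h
  guessTerms-sound pre (suc r) ρ ts K (a , h) = guessTerms-sound pre r (extend a ρ) _ K h

  guessTerms-complete : ∀ pre r (ρ : Env m v) ts (K : TermsCont pre) as → length as ≡ r →
    (∀ {v′} (ρ′ : Env m v′) ts′ → map (evalT ρ′) ts′ ≡ map (evalT ρ) ts ++ as → ρ′ ⊨⟨ pre ⟩ K ts′) →
    ρ ⊨⟨ replicate r ∃Q ++ pre ⟩ guessTerms pre r ts K
  guessTerms-complete pre zero    ρ ts K []       refl H = H ρ ts (sym (++-identityʳ _))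
  guessTerms-complete pre (suc r) ρ ts K (a ∷ as) len  H =
    a , guessTerms-complete pre r (extend a ρ) (map wkᵗ ts ++ var F.zero ∷ []) K as (suc-injective len)
          (λ ρ′ ts′ eq → H ρ′ ts′ (trans eq (trans (cong (_++ as) ts≡) (++-assoc (map (evalT ρ) ts) (a ∷ []) as))))
    where
    ts≡ : map (evalT (extend a ρ)) (map wkᵗ ts ++ var F.zero ∷ []) ≡ map (evalT ρ) ts ++ a ∷ []
    ts≡ = trans (map-++ (evalT (extend a ρ)) (map wkᵗ ts) (var F.zero ∷ []))
                (cong (_++ a ∷ []) (map-agree (extension-wkᵗ ρ a) ts))

value : ℕ → List ℕ → ℕ
value B []       = 0
value B (d ∷ ds) = d + B * value B ds

digitsOf : ∀ B .{{_ : NonZero B}} t y → y < B ^ t →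
  Σ (List ℕ) λ ds → length ds ≡ t × All (_< B) ds × value B ds ≡ y
digitsOf B zero    zero    _ = [] , refl , [] , refl
digitsOf B zero    (suc y) (s≤s ())
digitsOf B (suc t) y       y<B^1+t =
  let (ds , len , ds<B , ds≡) = digitsOf B t (y / B) (m<n*o⇒m/o<n (subst (y <_) (*-comm B (B ^ t)) y<B^1+t))
  in y % B ∷ ds , cong suc len , m%n<n y B ∷ ds<B , (begin
       y % B + B * value B ds   ≡⟨ cong (λ q → y % B + B * q) ds≡ ⟩
       y % B + B * (y / B)      ≡⟨ cong (y % B +_) (*-comm B (y / B)) ⟩
       y % B + y / B * B        ≡⟨ sym (m≡m%n+[m/n]*n y B) ⟩
       y                        ∎)
  where open ≡-Reasoning

lookupMaybe : ∀ {X : Set} → List X → ℕ → Maybe X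
lookupMaybe []       i       = nothing
lookupMaybe (x ∷ xs) zero    = just x
lookupMaybe (x ∷ xs) (suc i) = lookupMaybe xs i

lookupMaybe-∈ : ∀ {X : Set} (xs : List X) i {x} → lookupMaybe xs i ≡ just x → x ∈ xs
lookupMaybe-∈ (y ∷ xs) zero    refl = here refl
lookupMaybe-∈ (y ∷ xs) (suc i) eq   = there (lookupMaybe-∈ xs i eq)

∈-lookupMaybe : ∀ {X : Set} {xs : List X} {x} → x ∈ xs → ∃ λ i → i < length xs × lookupMaybe xs i ≡ just x
∈-lookupMaybe (here refl) = 0 , z<s , refl
∈-lookupMaybe (there x∈)  = let (i , i< , eq) = ∈-lookupMaybe x∈ in suc i , s≤s i< , eq

∈-of-letters : ∀ {X : Set} {m} (w : Vec X (suc m)) (A : List (Vec X (suc m))) i →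
  (∀ p → Σ (Vec X (suc m)) λ u → lookupMaybe A i ≡ just u × lookup w p ≡ lookup u p) → w ∈ A
∈-of-letters w A i letters =
  let (u₀ , found₀ , _) = letters F.zero
      w≗u₀ : ∀ p → lookup w p ≡ lookup u₀ p
      w≗u₀ p = let (u , found , same) = letters p in
               trans same (cong (λ u → lookup u p) (just-injective (trans (sym found) found₀)))
      w≡u₀ = trans (sym (tabulate∘lookup w)) (trans (tabulate-cong w≗u₀) (tabulate∘lookup u₀))
  in subst (_∈ A) (sym w≡u₀) (lookupMaybe-∈ A i found₀)

definingPrefix : (R t₁ t₂ k : ℕ) → Prefix
definingPrefix R t₁ t₂ k = replicate R ∃Q ++ replicate t₁ ∃Q ++ ∀Q ∷ replicate t₂ ∃Q ++ game k

-- After the index digits, var F.zero is the ∀-bound position p; wk₂ carries it past the position digits.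
definingMatrix : ∀ k m R t₁ t₂ → List (Vec Bool (suc m)) → Prenex (definingPrefix R t₁ t₂ k) 0
definingMatrix k m R t₁ t₂ A =
  guessTerms (replicate t₁ ∃Q ++ ∀Q ∷ replicate t₂ ∃Q ++ game k) R [] λ rungs →
  readDigits (∀Q ∷ replicate t₂ ∃Q ++ game k) t₁ rungs λ wk₁ ds₁ →
  readDigits (game k) t₂ (map (wkᵗ ∘ wk₁) rungs) λ wk₂ ds₂ →
  agreesAt k m (lookupMaybe A (value R ds₁)) (value R ds₂) (wk₂ (var F.zero))

definingSentence : ∀ k m R t₁ t₂ → List (Vec Bool (suc m)) → Sentence
definingSentence k m R t₁ t₂ A = close (definingPrefix R t₁ t₂ k) (definingMatrix k m R t₁ t₂ A)

module DefiningSemantics {m : ℕ} (w : Vec Bool (suc m)) where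
  open Semantics w
  open PositionSemantics w
  open ReadingSemantics w

  defining-sound : ∀ k R t₁ t₂ (A : List (Vec Bool (suc m))) → m ≤ reach k →
    w ⊨ definingSentence k m R t₁ t₂ A → w ∈ A
  defining-sound k R t₁ t₂ A m≤reach h =
    let (_ , ρ₁ , rungs , h₁) = guessTerms-sound _ R emptyEnv [] _ h
        (e₁ , ds₁ , h₂) = readDigits-sound _ t₁ ρ₁ rungs _ h₁
    in ∈-of-letters w A (value R ds₁) λ p →
         let (e₂ , _ , h₃) = readDigits-sound (game k) t₂ (extend p (env e₁)) _ _ (h₂ p)
             (u , found , same) = agreesAt-sound k _ _ (env e₂) _ m≤reach h₃
         in u , found , subst (λ q → lookup w q ≡ lookup u q) (agree e₂ (var F.zero)) same

  defining-complete : ∀ k R t₁ t₂ (A : List (Vec Bool (suc m))) .{{_ : NonZero R}} → w ∈ A → m ≤ reach k →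
    R ≤ suc m → length A ≤ R ^ t₁ → suc m ≤ R ^ t₂ → w ⊨ definingSentence k m R t₁ t₂ A
  defining-complete k R t₁ t₂ A w∈A m≤reach R≤n A≤ n≤ =
    let (i , i< , found) = ∈-lookupMaybe w∈A
        (ds₁ , len₁ , ds₁< , ds₁≡) = digitsOf R t₁ i (<-≤-trans i< A≤)
        (vals , len , cons) = consecutive 0 R R≤n
        digits< : ∀ {ds} → All (_< R) ds → All (_< length vals) ds
        digits< = subst (λ n → All (_< n) _) (sym len)
    in guessTerms-complete _ R emptyEnv [] _ vals len λ ρ₁ rungs rungs≡ →
       readDigits-complete _ t₁ ρ₁ rungs _ vals rungs≡ cons ds₁ len₁ (digits< ds₁<) λ e₁ p →
       let e = e₁ ⨾ extension-wkᵗ (env e₁) p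
           (ds₂ , len₂ , ds₂< , ds₂≡) = digitsOf R t₂ (toℕ p) (<-≤-trans (FP.toℕ<n p) n≤)
       in readDigits-complete (game k) t₂ (env e) (map (embed e) rungs) _ vals
            (trans (map-agree e rungs) rungs≡) cons ds₂ len₂ (digits< ds₂<) λ e₂ →
          agreesAt-complete k _ _ (env e₂) _ (trans (cong (lookupMaybe A) ds₁≡) found) m≤reach
            (trans (cong toℕ (agree e₂ (var F.zero))) (sym ds₂≡))

log₂-bracket : ∀ m → ∃ λ ℓ → 2 ^ ℓ ≤ suc m × suc m < 2 ^ suc ℓ
log₂-bracket zero = 0 , ≤-refl , s≤s (s≤s z≤n)
log₂-bracket (suc m) with log₂-bracket m
... | ℓ , lo , hi with suc (suc m) <? 2 ^ suc ℓ
...   | yes hi′ = ℓ , m≤n⇒m≤1+n lo , hi′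
...   | no ¬hi′ = suc ℓ , ≤-reflexive (sym n≡) , subst (_< 2 ^ suc (suc ℓ)) (sym n≡) y<2y
  where
  n≡ : suc (suc m) ≡ 2 ^ suc ℓ
  n≡ = ≤-antisym hi (≮⇒≥ ¬hi′)
  y<2y : 2 ^ suc ℓ < 2 * 2 ^ suc ℓ
  y<2y = m<m+n (2 ^ suc ℓ) (≤-trans (m^n>0 2 (suc ℓ)) (m≤m+n _ 0))

halving : ∀ n → ⌊ n /2⌋ + ⌊ n /2⌋ ≤ n × n ≤ suc (⌊ n /2⌋ + ⌊ n /2⌋)
halving zero          = z≤n , z≤n
halving (suc zero)    = z≤n , ≤-refl
halving (suc (suc n)) =
  let (lo , hi) = halving n
      h = ⌊ n /2⌋
  in s≤s (≤-trans (≤-reflexive (+-suc h h)) (s≤s lo)) ,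
     s≤s (≤-trans (s≤s hi) (≤-reflexive (cong suc (sym (+-suc h h)))))

division-bracket : ∀ ℓ r .{{_ : NonZero r}} → ℓ < r * suc (ℓ / r) × r * suc (ℓ / r) ≤ r + ℓ
division-bracket ℓ r = lower , upper
  where
  open ≤-Reasoning
  r*[1+q]≡ : r * suc (ℓ / r) ≡ r + ℓ / r * r
  r*[1+q]≡ = trans (*-suc r (ℓ / r)) (cong (r +_) (*-comm r (ℓ / r)))
  lower : ℓ < r * suc (ℓ / r)
  lower = begin-strict
    ℓ                      ≡⟨ m≡m%n+[m/n]*n ℓ r ⟩
    ℓ % r + ℓ / r * r      <⟨ +-monoˡ-< (ℓ / r * r) (m%n<n ℓ r) ⟩
    r + ℓ / r * r          ≡⟨ sym r*[1+q]≡ ⟩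
    r * suc (ℓ / r)        ∎
  upper : r * suc (ℓ / r) ≤ r + ℓ
  upper = ≤-trans (≤-reflexive r*[1+q]≡) (+-monoʳ-≤ r (m/n*n≤m ℓ r))

4^k<2*reach : ∀ k → 4 ^ k < 2 * reach k
4^k<2*reach zero    = s≤s (s≤s z≤n)
4^k<2*reach (suc k) = begin-strict
  4 * 4 ^ k                ≤⟨ n≤1+n _ ⟩
  suc (4 * 4 ^ k)          <⟨ n<1+n _ ⟩
  2 + 4 * 4 ^ k            ≡⟨ cong (_∸ 2) (sym (*-suc 4 (4 ^ k))) ⟩
  4 * suc (4 ^ k) ∸ 2      ≤⟨ ∸-monoˡ-≤ 2 (*-monoʳ-≤ 4 (4^k<2*reach k)) ⟩
  4 * (2 * reach k) ∸ 2    ≡⟨ cong (_∸ 2) (trans (sym (*-assoc 4 2 (reach k))) (*-assoc 2 4 (reach k))) ⟩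
  2 * (4 * reach k) ∸ 2    ≡⟨ sym (*-distribˡ-∸ 2 (4 * reach k) 1) ⟩
  2 * (4 * reach k ∸ 1)    ∎
  where open ≤-Reasoning

reach-covers : ∀ m ℓ → suc m < 2 ^ suc ℓ → m ≤ reach (suc ⌊ suc ℓ /2⌋)
reach-covers m ℓ n<2^1+ℓ = <⇒≤ (*-cancelˡ-< 2 m (reach k) (begin-strict
  2 * m                ≤⟨ *-monoʳ-≤ 2 (n≤1+n m) ⟩
  2 * suc m            ≤⟨ *-monoʳ-≤ 2 (<⇒≤ n<2^1+ℓ) ⟩
  2 ^ suc (suc ℓ)      ≤⟨ ^-monoʳ-≤ 2 2+ℓ≤k+k ⟩
  2 ^ (k + k)          ≡⟨ cong (2 ^_) (cong (k +_) (sym (+-identityʳ k))) ⟩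
  2 ^ (2 * k)          ≡⟨ sym (^-*-assoc 2 2 k) ⟩
  4 ^ k                <⟨ 4^k<2*reach k ⟩
  2 * reach k          ∎))
  where
  open ≤-Reasoning
  h = ⌊ suc ℓ /2⌋
  k = suc h
  2+ℓ≤k+k : suc (suc ℓ) ≤ k + k
  2+ℓ≤k+k = s≤s (≤-trans (proj₂ (halving (suc ℓ))) (≤-reflexive (sym (+-suc h h))))

n<2^n : ∀ n → n < 2 ^ n
n<2^n zero    = s≤s z≤n
n<2^n (suc n) = +-mono-≤ (m^n>0 2 n) (≤-trans (n<2^n n) (m≤m+n _ 0))

n≤n^t : ∀ n t → 1 ≤ t → n ≤ n ^ t
n≤n^t zero    (suc t) _ = z≤n
n≤n^t (suc n) (suc t) _ =
  ≤-trans (≤-reflexive (sym (*-identityʳ (suc n)))) (*-monoʳ-≤ (suc n) (m^n>0 (suc n) t))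

poly≤pow : ∀ R c K t n → 2 ≤ R → n ≤ R ^ t → c * n ^ K ≤ R ^ (c + K * t)
poly≤pow R c K t n 2≤R n≤R^t = begin
  c * n ^ K              ≤⟨ *-mono-≤ (≤-trans (<⇒≤ (n<2^n c)) (^-monoˡ-≤ c 2≤R)) (^-monoˡ-≤ K n≤R^t) ⟩
  R ^ c * (R ^ t) ^ K    ≡⟨ cong (R ^ c *_) (trans (^-*-assoc R t K) (cong (R ^_) (*-comm t K))) ⟩
  R ^ c * R ^ (K * t)    ≡⟨ sym (^-distribˡ-+-* R c (K * t)) ⟩
  R ^ (c + K * t)        ∎
  where open ≤-Reasoning

n≤[2^r⊓n]^t : ∀ r n t → 1 ≤ t → n ≤ 2 ^ (r * t) → n ≤ (2 ^ r ⊓ n) ^ t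
n≤[2^r⊓n]^t r n t 1≤t n≤2^rt with 2 ^ r ≤? n
... | yes 2^r≤n =
  subst (λ R → n ≤ R ^ t) (sym (m≤n⇒m⊓n≡m 2^r≤n)) (subst (n ≤_) (sym (^-*-assoc 2 r t)) n≤2^rt)
... | no 2^r≰n  =
  subst (λ R → n ≤ R ^ t) (sym (m≥n⇒m⊓n≡n (<⇒≤ (≰⇒> 2^r≰n)))) (n≤n^t n t 1≤t)

sumBelow : (ℕ → ℕ) → ℕ → ℕ
sumBelow f zero    = 0
sumBelow f (suc N) = f N + sumBelow f N

≤-sumBelow : ∀ f N i → i < N → f i ≤ sumBelow f N
≤-sumBelow f (suc N) i (s≤s i≤N) with m≤n⇒m<n∨m≡n i≤N
... | inj₁ i<N  = ≤-trans (≤-sumBelow f N i i<N) (m≤n+m _ (f N))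
... | inj₂ refl = m≤m+n (f i) _

bigO-everywhere : ∀ f K → BigOPow f K → ∃ λ c → ∀ n → 1 ≤ n → f n ≤ c * n ^ K
bigO-everywhere f K (c , N , f≤) = c + sumBelow f N , bound
  where
  bound : ∀ n → 1 ≤ n → f n ≤ (c + sumBelow f N) * n ^ K
  bound n 1≤n with N ≤? n
  ... | yes N≤n = ≤-trans (f≤ n N≤n) (*-monoˡ-≤ (n ^ K) (m≤m+n c _))
  ... | no N≰n  = begin
    f n                          ≤⟨ ≤-sumBelow f N n (≰⇒> N≰n) ⟩
    sumBelow f N                 ≡⟨ sym (*-identityʳ _) ⟩
    sumBelow f N * 1             ≤⟨ *-mono-≤ (m≤n+m _ c) (subst (_≤ n ^ K) (^-zeroˡ K) (^-monoˡ-≤ K 1≤n)) ⟩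
    (c + sumBelow f N) * n ^ K   ∎
    where open ≤-Reasoning

length-definingPrefix : ∀ R t₁ t₂ k → length (definingPrefix R t₁ t₂ k) ≡ R + (t₁ + suc (t₂ + (k + k)))
length-definingPrefix R t₁ t₂ k = begin
  length (replicate R ∃Q ++ replicate t₁ ∃Q ++ ∀Q ∷ replicate t₂ ∃Q ++ game k)
    ≡⟨ length-++ (replicate R ∃Q) ⟩
  length (replicate R ∃Q) + length (replicate t₁ ∃Q ++ ∀Q ∷ replicate t₂ ∃Q ++ game k)
    ≡⟨ cong₂ _+_ (length-replicate R) (length-++ (replicate t₁ ∃Q)) ⟩
  R + (length (replicate t₁ ∃Q) + suc (length (replicate t₂ ∃Q ++ game k)))
    ≡⟨ cong (λ l → R + (l + _)) (length-replicate t₁) ⟩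
  R + (t₁ + suc (length (replicate t₂ ∃Q ++ game k)))
    ≡⟨ cong (λ l → R + (t₁ + suc l)) (length-++ (replicate t₂ ∃Q)) ⟩
  R + (t₁ + suc (length (replicate t₂ ∃Q) + length (game k)))
    ≡⟨ cong (λ l → R + (t₁ + suc l)) (cong₂ _+_ (length-replicate t₂) (length-game k)) ⟩
  R + (t₁ + suc (t₂ + (k + k)))
    ∎
  where open ≡-Reasoning

quantBound-zero : ∀ a b C n → QuantBound a b C (suc n) 0
quantBound-zero a b C n =
  subst (λ e → 2 ^ e ≤ suc n ^ (a + b)) (sym (trans (cong (b *_) (0∸n≡0 C)) (*-zeroʳ b)))
    (m^n>0 (suc n) (a + b))

quantBound-of-budget : ∀ a b C n q ℓ → 1 ≤ a → 2 ^ ℓ ≤ suc n → b * q ≤ b * C + suc b * ℓ →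
  QuantBound a b C (suc n) q
quantBound-of-budget a b C n q ℓ 1≤a 2^ℓ≤n budget = begin
  2 ^ (b * (q ∸ C))    ≤⟨ ^-monoʳ-≤ 2 b[q∸C]≤ ⟩
  2 ^ (ℓ * suc b)      ≡⟨ sym (^-*-assoc 2 ℓ (suc b)) ⟩
  (2 ^ ℓ) ^ suc b      ≤⟨ ^-monoˡ-≤ (suc b) 2^ℓ≤n ⟩
  suc n ^ suc b        ≤⟨ ^-monoʳ-≤ (suc n) (+-monoˡ-≤ b 1≤a) ⟩
  suc n ^ (a + b)      ∎
  where
  open ≤-Reasoning
  b[q∸C]≤ : b * (q ∸ C) ≤ ℓ * suc b
  b[q∸C]≤ = ≤-trans (≤-reflexive (*-distribˡ-∸ b q C))
              (≤-trans (m≤n+o⇒m∸n≤o (b * q) (b * C) budget) (≤-reflexive (*-comm (suc b) ℓ)))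

count-budget : ∀ K b R c t₂ k ℓ → 1 ≤ b → R ≤ 2 ^ (suc K * b) → k + k ≤ 3 + ℓ →
  suc K * b * t₂ ≤ suc K * b + ℓ →
  b * (R + (c + K * t₂ + suc (t₂ + (k + k)))) ≤ b * (2 ^ (suc K * b) + c + suc K * b + 4) + suc b * ℓ
count-budget K b@(suc b′) R c t₂ k ℓ _ R≤ k+k≤ rt₂≤ = begin
  b * (R + (c + K * t₂ + suc (t₂ + (k + k))))   ≤⟨ *-monoʳ-≤ b (+-mono-≤ R≤ (+-monoʳ-≤ (c + K * t₂) (s≤s t₂+k+k≤))) ⟩
  b * (P + (c + K * t₂ + suc (t₂ + (3 + ℓ))))   ≡⟨ expand b P c K t₂ ℓ ⟩
  b * (P + c + 4) + b * ℓ + r * t₂              ≤⟨ +-monoʳ-≤ (b * (P + c + 4) + b * ℓ) rt₂≤ ⟩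
  b * (P + c + 4) + b * ℓ + (r + ℓ)             ≤⟨ m≤m+n _ (b′ * r) ⟩
  b * (P + c + 4) + b * ℓ + (r + ℓ) + b′ * r    ≡⟨ regroup b′ P c r ℓ ⟩
  b * (P + c + r + 4) + suc b * ℓ               ∎
  where
  open ≤-Reasoning
  r = suc K * b
  P = 2 ^ r
  t₂+k+k≤ = +-monoʳ-≤ t₂ k+k≤
  expand : ∀ b P c K t ℓ →
    b * (P + (c + K * t + suc (t + (3 + ℓ)))) ≡ b * (P + c + 4) + b * ℓ + suc K * b * t
  expand = solve-∀
  regroup : ∀ b′ P c r ℓ →
    suc b′ * (P + c + 4) + suc b′ * ℓ + (r + ℓ) + b′ * r ≡ suc b′ * (P + c + r + 4) + suc (suc b′) * ℓ
  regroup = solve-∀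

Defines : ∀ {m} → Sentence → List (Vec Bool (suc m)) → Set
Defines {m} φ A = (w : Vec Bool (suc m)) → (w ∈ A → w ⊨ φ) × (w ∉ A → ¬ (w ⊨ φ))

singleton-≡ : ∀ {X : Set} (x y : Vec X 1) → lookup x F.zero ≡ lookup y F.zero ⇔ x ≡ y
singleton-≡ (a ∷ []) (b ∷ []) = mk⇔ (cong (_∷ [])) (cong (λ u → lookup u F.zero))

oneLetter : List (Vec Bool 1) → QF 0
oneLetter []      = ⊥₀
oneLetter (u ∷ A) = lit (lookup u F.zero) tmin ∨₀ oneLetter A

oneLetter-defines : (A : List (Vec Bool 1)) → Defines ⌜ oneLetter A ⌝ A
oneLetter-defines A w = from (sem A) , λ w∉A h → w∉A (to (sem A) h)
  where
  open Semantics w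
  open PositionSemantics w
  sem : ∀ A → emptyEnv ⊨₀ oneLetter A ⇔ w ∈ A
  sem []      = mk⇔ (λ h → ⊥-elim (h refl)) λ ()
  sem (u ∷ A) = ⇔-trans (⇔-trans (lit-sem _ emptyEnv tmin) (singleton-≡ w u) ⊎-⇔ sem A)
                  (mk⇔ [ here , there ]′ λ where (here w≡u) → inj₁ w≡u
                                                 (there w∈A) → inj₂ w∈A)

-- With ℓ = ⌊log₂ n⌋ and r = (K+1)b: R = min(2^r, n) rungs; t₂ = ⌊ℓ/r⌋ + 1 position digits, so
-- that R^t₂ ≥ n; t₁ = c + K t₂ index digits, so that R^t₁ ≥ c n^K ≥ |A|; k rounds with
-- 2k ≤ ℓ + 3. The count R + t₁ + 1 + t₂ + 2k is ℓ + (K+1) t₂ + O(1) ≤ (1 + 1/b) ℓ + O(1).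
polynomial-family-definable : ∀ K c a b → 1 ≤ a → 1 ≤ b → ∀ m (A : List (Vec Bool (suc (suc m)))) →
  length A ≤ c * suc (suc m) ^ K →
  Σ Sentence λ φ → QuantBound a b (2 ^ (suc K * b) + c + suc K * b + 4) (suc (suc m)) (qcount φ) × Defines φ A
polynomial-family-definable K c a b@(suc _) 1≤a 1≤b m A |A|≤ with log₂-bracket (suc m)
... | ℓ , 2^ℓ≤n , n<2^1+ℓ = φ , bound , defines
  where
  n = suc (suc m)
  r = suc K * b
  k = suc ⌊ suc ℓ /2⌋
  t₂ = suc (ℓ / r)
  t₁ = c + K * t₂
  R = 2 ^ r ⊓ n
  φ = definingSentence k (suc m) R t₁ t₂ A
  2≤R : 2 ≤ R
  2≤R = ⊓-glb (^-monoʳ-≤ 2 {1} {r} (s≤s z≤n)) (s≤s (s≤s z≤n))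
  n≤R^t₂ : n ≤ R ^ t₂
  n≤R^t₂ = n≤[2^r⊓n]^t r n t₂ (s≤s z≤n)
             (≤-trans (<⇒≤ n<2^1+ℓ) (^-monoʳ-≤ 2 (proj₁ (division-bracket ℓ r))))
  k+k≤ : k + k ≤ 3 + ℓ
  k+k≤ = s≤s (≤-trans (≤-reflexive (+-suc _ _)) (s≤s (proj₁ (halving (suc ℓ)))))
  m≤reach : suc m ≤ reach k
  m≤reach = reach-covers (suc m) ℓ n<2^1+ℓ
  bound : QuantBound a b (2 ^ r + c + r + 4) n (qcount φ)
  bound = subst (QuantBound a b (2 ^ r + c + r + 4) n)
            (sym (trans (qcount-close (definingPrefix R t₁ t₂ k) _) (length-definingPrefix R t₁ t₂ k)))
            (quantBound-of-budget a b (2 ^ r + c + r + 4) (suc m) _ ℓ 1≤a 2^ℓ≤n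
              (count-budget K b R c t₂ k ℓ 1≤b (m⊓n≤m (2 ^ r) n) k+k≤ (proj₂ (division-bracket ℓ r))))
  defines : Defines φ A
  defines w = (λ w∈A → defining-complete k R t₁ t₂ A {{>-nonZero (≤-trans (s≤s z≤n) 2≤R)}} w∈A m≤reach
                          (m⊓n≤n (2 ^ r) n) (≤-trans |A|≤ (poly≤pow R c K t₂ n 2≤R n≤R^t₂)) n≤R^t₂)
            , (λ w∉A h → w∉A (defining-sound k R t₁ t₂ A m≤reach h))
    where open DefiningSemantics w

theorem5p4 : (f : ℕ → ℕ) → (∃ λ k → BigOPow f k) → TendsToInfinity f →
    (a b : ℕ) → 1 ≤ a → 1 ≤ b →
    ∃ λ C → (m : ℕ) → (A : List (Vec Bool (suc m))) → Unique A → length A ≡ f (suc m) →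
      Σ Sentence λ φ → QuantBound a b C (suc m) (qcount φ) ×
        ((w : Vec Bool (suc m)) → (w ∈ A → w ⊨ φ) × (w ∉ A → ¬ (w ⊨ φ)))
theorem5p4 f (K , f-poly) _ a b 1≤a 1≤b with bigO-everywhere f K f-poly
... | c , f≤ = C , sentence
  where
  C = 2 ^ (suc K * b) + c + suc K * b + 4
  -- For n = 1 there is no room for two distinct rungs, but a disjunction of literals suffices.
  sentence : ∀ m (A : List (Vec Bool (suc m))) → Unique A → length A ≡ f (suc m) →
    Σ Sentence λ φ → QuantBound a b C (suc m) (qcount φ) × Defines φ A
  sentence zero    A _ _ =
    ⌜ oneLetter A ⌝ ,
    subst (QuantBound a b C 1) (sym (qcount-⌜⌝ (oneLetter A))) (quantBound-zero a b C 0) ,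
    oneLetter-defines A
  sentence (suc m) A _ |A|≡ =
    polynomial-family-definable K c a b 1≤a 1≤b m A (subst (_≤ _) (sym |A|≡) (f≤ (suc (suc m)) (s≤s z≤n)))
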